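{- Let $n\geq 5$ be an integer. Then $\big|\mathcal{A}^\circ_n(2431; 1324)\big|_2^2\big|_3^3\big| = \big|\mathcal{A}^\circ_{n-1}(2431; 1324)\big|_2^2\big|$.
   Context: Let $S_n$ be the symmetric group on $[n]=\{1,\dots,n\}$. A permutation $\pi\in S_n$ has one-line form $\pi_1\pi_2\cdots\pi_n$ with $\pi_i=\pi(i)$. For a word $w=w_1\cdots w_n$ of distinct integers and $\tau=\tau_1\cdots\tau_k\in S_k$, $w$ contains $\tau$ if there are indices $i_1<\cdots<i_k$ with $w_{i_s}>w_{i_t}$ iff $\tau_s>\tau_t$ for all $1\le s<t\le k$; otherwise $w$ avoids $\tau$. A permutation $\pi\in S_n$ is a cyclic permutation if it consists of a single $n$-cycle $\pi=(c_1,\dots,c_n)$ (meaning $\pi(c_i)=c_{i+1}$ for $i<n$, $\pi(c_n)=c_1$). Its cycle forms are the words $c_ic_{i+1}\cdots c_nc_1\cdots c_{i-1}$, $1\le i\le n$; the standard cycle form is the one with first entry $1$. $\mathcal{A}^\circ_n(\sigma;\tau)$ is the set of cyclic permutations in $S_n$ whose one-line form avoids $\sigma$ and all of whose cycle forms avoid $\tau$. $\mathcal{A}^\circ_n(\sigma;\tau)\big|_2^2$ is the set of $\pi\in\mathcal{A}^\circ_n(\sigma;\tau)$ whose standard cycle form is $(1,2,c_3,\dots,c_n)$ (i.e. $\pi(1)=2$), and $\mathcal{A}^\circ_n(\sigma;\tau)\big|_2^2\big|_3^3$ is the set of $\pi\in\mathcal{A}^\circ_n(\sigma;\tau)$ whose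 standard cycle form is $(1,2,3,c_4,\dots,c_n)$. -}

module Defs where

-- Conventions: we work 0-based.  A map on [n] is represented by its one-line
-- form, a vector v : Vec (Fin n) n with π(i) = lookup v i, where the paper's
-- value k ∈ [n] corresponds to Fin index k-1.  Shifting all values by one
-- does not change pattern containment.  All predicates are Boolean so that
-- the sets can be counted by filtering an explicit enumeration.

open import Data.Bool using (Bool; true; false; _∧_; _∨_; not; if_then_else_)
open import Data.Nat using (ℕ; zero; suc; _<ᵇ_; _≡ᵇ_)
open import Data.Fin using (Fin; toℕ)
open import Data.Vec using (Vec; []; _∷_; lookup; toList)
open import Data.List using (List; []; _∷_; map; concatMap; length; filterᵇ; _++_; zip; allFin)
open import Data.Bool.ListAction using (and; or)

allVecs : (n m : ℕ) → List (Vec (Fin n) m)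
allVecs n zero = [] ∷ []
allVecs n (suc m) = concatMap (λ x → map (x ∷_) (allVecs n m)) (allFin n)

subseqs : List ℕ → List (List ℕ)
subseqs [] = [] ∷ []
subseqs (x ∷ xs) = let r = subseqs xs in map (x ∷_) r ++ r

_==_ : Bool → Bool → Bool
true == b = b
false == b = not b

sameOrder : List ℕ → List ℕ → Bool
sameOrder [] [] = true
sameOrder (a ∷ u) (b ∷ τ) =
  and (map (λ p → (Data.Product.proj₁ p <ᵇ a) == (Data.Product.proj₂ p <ᵇ b)) (zip u τ))
  ∧ sameOrder u τ
  where import Data.Product
sameOrder _ _ = false

contains : List ℕ → List ℕ → Bool
contains w τ = or (map (λ u → sameOrder u τ) (subseqs w))

avoids : List ℕ → List ℕ → Bool
avoids w τ = not (contains w τ)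

iter : {n : ℕ} → Vec (Fin n) n → ℕ → Fin n → Fin n
iter v zero i = i
iter v (suc k) i = lookup v (iter v k i)

orbit : {n : ℕ} → Vec (Fin n) n → ℕ → Fin n → List (Fin n)
orbit v zero i = []
orbit v (suc m) i = i ∷ orbit v m (lookup v i)

distinct : List ℕ → Bool
distinct [] = true
distinct (x ∷ xs) = not (or (map (x ≡ᵇ_) xs)) ∧ distinct xs

oneLine : {n : ℕ} → Vec (Fin n) n → List ℕ
oneLine v = map toℕ (toList v)

-- π is a cyclic permutation (a single n-cycle): starting from the smallest
-- element, the n iterates π⁰(1),…,π^{n-1}(1) are distinct and π^n(1) = 1.
isCyclic : {n : ℕ} → Vec (Fin n) n → Bool
isCyclic {zero} v = false
isCyclic {suc n} v =
  distinct (map toℕ (orbit v (suc n) Fin.zero))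
  ∧ (toℕ (iter v (suc n) Fin.zero) ≡ᵇ 0)
  where import Data.Fin as Fin

standardCycleForm : {n : ℕ} → Vec (Fin n) n → List ℕ
standardCycleForm {zero} v = []
standardCycleForm {suc n} v = map toℕ (orbit v (suc n) Data.Fin.zero)

rotate : List ℕ → List ℕ
rotate [] = []
rotate (x ∷ xs) = xs ++ (x ∷ [])

rotations : List ℕ → List (List ℕ)
rotations w = go (length w) w
  where
  go : ℕ → List ℕ → List (List ℕ)
  go zero u = []
  go (suc k) u = u ∷ go k (rotate u)

inA : {n : ℕ} → List ℕ → List ℕ → Vec (Fin n) n → Bool
inA σ τ v = isCyclic v ∧ avoids (oneLine v) σ
          ∧ and (map (λ c → avoids c τ) (rotations (standardCycleForm v)))

startsWith : List ℕ → List ℕ → Bool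
startsWith [] w = true
startsWith (a ∷ p) [] = false
startsWith (a ∷ p) (b ∷ w) = (a ≡ᵇ b) ∧ startsWith p w

-- |A°_n(σ;τ)| restricted to standard cycle form beginning with prefix p
-- (0-based values: prefix (1,2) is [0,1], prefix (1,2,3) is [0,1,2])
countA : (n : ℕ) → List ℕ → List ℕ → List ℕ → ℕ
countA n σ τ p =
  length (filterᵇ (λ v → inA σ τ v ∧ startsWith p (standardCycleForm v)) (allVecs n n))

p2431 : List ℕ
p2431 = 1 ∷ 3 ∷ 2 ∷ 0 ∷ []

p1324 : List ℕ
p1324 = 0 ∷ 2 ∷ 1 ∷ 3 ∷ []

{-# OPTIONS --safe #-}
module Submission where

-- For a cyclic permutation π = (1, c₂, …, c_{n-1}) of [n-1] let π′ = (1, 2, c₂+1, …, c_{n-1}+1);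
-- π ↦ π′ is a bijection from the π with π(1) = 2 onto the cyclic permutations of [n] with
-- π′(1) = 2 and π′(2) = 3.  In the one-line form and in every cycle form, π′ arises from π by
-- replacing one entry k by the (cyclically) adjacent entries k, k+1 and raising the entries
-- above k.  Hence an occurrence of a pattern in π yields one in π′, and an occurrence in π′
-- yields one in π unless it uses both k and k+1.  That would need two (cyclically) adjacent
-- entries of the pattern with consecutive values in increasing order, and neither 2431 nor
-- 1324 read cyclically has such a pair.

open import Defs
open import Data.Bool using (Bool; true; false; _∧_; _∨_; not; T)
open import Data.Bool.ListAction using (and; or; any; all)
open import Data.Bool.Properties using (T-∧; ∧-zeroʳ)
open import Data.Empty using (⊥-elim)
open import Data.Fin using (Fin; zero; suc; toℕ; punchIn; _≟_)
open import Data.Fin.Properties using (pigeonhole; toℕ<n; toℕ-injective; punchInᵢ≢i; 0≢1+n)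
import Data.Fin.Properties as Finₚ
open import Data.List
  using (List; []; _∷_; map; _++_; length; zip; iterate; concatMap; filter; filterᵇ; allFin)
open import Data.List.Properties
  using ( map-++; map-∘; map-cong; map-cong-local; ++-identityʳ; ++-assoc; ∷-injective; map-tabulate
        ; concatMap-map; map-concatMap; concatMap-cong; filter-++; filter-none; filter-≐; length-map)
open import Data.List.Membership.Propositional using (_∈_; find; lose)
open import Data.List.Membership.Propositional.Properties
  using (∈-++⁺ˡ; ∈-++⁺ʳ; ∈-++⁻; ∈-map⁺; ∈-map⁻)
open import Data.List.Relation.Binary.Sublist.Propositional
  using (_⊆_; []; _∷_; _∷ʳ_; ⊆-refl; ⊆-trans)
open import Data.List.Relation.Binary.Sublist.Propositional.Properties using (All-resp-⊆; ++⁺)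
open import Data.List.Relation.Unary.All as All using (All; []; _∷_)
import Data.List.Relation.Unary.All.Properties as All
open import Data.List.Relation.Unary.Any using (Any; here; there)
open import Data.List.Relation.Unary.Any.Properties using (any⁺; any⁻)
open import Data.Nat using (ℕ; zero; suc; _+_; _≤_; _<_; _∸_; s≤s; z≤n; _<ᵇ_; _≡ᵇ_)
import Data.Nat.GeneralisedArithmetic as ℕ
open import Data.Nat.Properties
  using (n≢0⇒n>0; ≡ᵇ⇒≡; ≡⇒≡ᵇ; <-cmp; m≤n⇒m<n∨m≡n; n<1+n; suc-injective)
open import Data.Product using (∃; ∃₂; _×_; _,_; proj₁; proj₂)
open import Data.Sum using (_⊎_; inj₁; inj₂)
open import Data.Unit using (tt)
open import Data.Vec as Vec using (Vec; _∷_; lookup; toList)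
open import Data.Vec.Properties using (lookup-map; toList-map)
import Data.Vec.Relation.Unary.All as VecAll
open VecAll using (_∷_)
open import Data.Vec.Relation.Unary.All.Properties using (lookup⁻; toList⁺)
open import Function.Base using (_∘_; id)
open import Function.Bundles using (_⇔_; mk⇔; Equivalence)
open import Level using (Level)
open import Relation.Binary.Definitions using (tri<; tri≈; tri>)
open import Relation.Binary.PropositionalEquality
  using (_≡_; _≢_; refl; cong; cong₂; trans; sym; subst; subst₂; module ≡-Reasoning)
open import Relation.Nullary using (¬_; ¬?; _×-dec_; yes; no)
open import Relation.Nullary.Decidable using (T?)
open import Relation.Unary using (Pred; Decidable) renaming (_⊆_ to _⇒_)

private
  variable
    a p q : Level
    A B : Set a

T-∧⁻ : ∀ {a b} → T (a ∧ b) → T a × T b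
T-∧⁻ = Equivalence.to T-∧

T-⇔⇒≡ : ∀ {a b} → T a ⇔ T b → a ≡ b
T-⇔⇒≡ {false} {false} _ = refl
T-⇔⇒≡ {false} {true} a⇔b = ⊥-elim (Equivalence.from a⇔b _)
T-⇔⇒≡ {true} {false} a⇔b = ⊥-elim (Equivalence.to a⇔b _)
T-⇔⇒≡ {true} {true} _ = refl

T-not : ∀ {b} → T (not b) ⇔ (¬ T b)
T-not {false} = mk⇔ (λ _ ()) (λ _ → tt)
T-not {true} = mk⇔ (λ ()) (λ ¬t → ¬t tt)

∧-cong-under : ∀ {c c′ a a′ s s′} →
  c ≡ c′ → (T c′ → s ≡ s′) → (T c′ → T s′ → a ≡ a′) → (c ∧ a) ∧ s ≡ (c′ ∧ a′) ∧ s′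
∧-cong-under {c′ = false} refl _ _ = refl
∧-cong-under {c′ = true} {s′ = false} refl s≡ _ rewrite s≡ tt =
  trans (∧-zeroʳ _) (sym (∧-zeroʳ _))
∧-cong-under {c′ = true} {s′ = true} refl s≡ a≡ rewrite s≡ tt | a≡ tt tt = refl

module _ {P : Pred A p} (P? : Decidable P) where

  filter-map : ∀ (f : B → A) xs → filter P? (map f xs) ≡ map f (filter (P? ∘ f) xs)
  filter-map f [] = refl
  filter-map f (x ∷ xs) with P? (f x)
  ... | yes _ = cong (f x ∷_) (filter-map f xs)
  ... | no _ = filter-map f xs

  filter-concatMap : ∀ (f : B → List A) xs → filter P? (concatMap f xs) ≡ concatMap (filter P? ∘ f) xs
  filter-concatMap f [] = refl
  filter-concatMap f (x ∷ xs) =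
    trans (filter-++ P? (f x) (concatMap f xs)) (cong (filter P? (f x) ++_) (filter-concatMap f xs))

  filter-restrict : ∀ {Q : Pred A q} (Q? : Decidable Q) → P ⇒ Q →
                    ∀ xs → filter P? xs ≡ filter P? (filter Q? xs)
  filter-restrict Q? P⇒Q [] = refl
  filter-restrict Q? P⇒Q (x ∷ xs) with Q? x
  ... | yes _ with P? x
  ...   | yes _ = cong (x ∷_) (filter-restrict Q? P⇒Q xs)
  ...   | no _ = filter-restrict Q? P⇒Q xs
  filter-restrict Q? P⇒Q (x ∷ xs) | no ¬qx with P? x
  ...   | yes px = ⊥-elim (¬qx (P⇒Q px))
  ...   | no _ = filter-restrict Q? P⇒Q xs

concatMap-[] : ∀ (h : A → List B) → (∀ x → h x ≡ []) → ∀ xs → concatMap h xs ≡ []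
concatMap-[] h h≡[] [] = refl
concatMap-[] h h≡[] (x ∷ xs) =
  trans (cong (_++ concatMap h xs) (h≡[] x)) (concatMap-[] h h≡[] xs)

concatMap-allFin-suc : ∀ {n} (h : Fin (suc n) → List A) →
  concatMap h (allFin (suc n)) ≡ h zero ++ concatMap (h ∘ suc) (allFin n)
concatMap-allFin-suc {n = n} h = cong (h zero ++_)
  (trans (cong (concatMap h) (sym (map-tabulate id suc))) (concatMap-map h suc (allFin n)))

concatMap-allFin-punchIn : ∀ {n} (i : Fin (suc n)) (h : Fin (suc n) → List A) → h i ≡ [] →
  concatMap h (allFin (suc n)) ≡ concatMap (h ∘ punchIn i) (allFin n)
concatMap-allFin-punchIn {n = n} zero h h0≡[] =
  trans (concatMap-allFin-suc h) (cong (_++ concatMap (h ∘ suc) (allFin n)) h0≡[])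
concatMap-allFin-punchIn {n = suc n} (suc i) h hi≡[] = begin
  concatMap h (allFin (suc (suc n)))
    ≡⟨ concatMap-allFin-suc h ⟩
  h zero ++ concatMap (h ∘ suc) (allFin (suc n))
    ≡⟨ cong (h zero ++_) (concatMap-allFin-punchIn i (h ∘ suc) hi≡[]) ⟩
  h zero ++ concatMap (h ∘ suc ∘ punchIn i) (allFin n)
    ≡⟨ concatMap-allFin-suc (h ∘ punchIn (suc i)) ⟨
  concatMap (h ∘ punchIn (suc i)) (allFin (suc n)) ∎
  where open ≡-Reasoning

concatMap-allFin-single : ∀ {n} (i : Fin n) (h : Fin n → List A) → (∀ j → j ≢ i → h j ≡ []) →
  concatMap h (allFin n) ≡ h i
concatMap-allFin-single {n = suc n} zero h h≡[] = begin
  concatMap h (allFin (suc n))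
    ≡⟨ concatMap-allFin-suc h ⟩
  h zero ++ concatMap (h ∘ suc) (allFin n)
    ≡⟨ cong (h zero ++_) (concatMap-[] (h ∘ suc) (λ j → h≡[] (suc j) λ ()) (allFin n)) ⟩
  h zero ++ []
    ≡⟨ ++-identityʳ (h zero) ⟩
  h zero ∎
  where open ≡-Reasoning
concatMap-allFin-single {n = suc n} (suc i) h h≡[] = begin
  concatMap h (allFin (suc n))
    ≡⟨ concatMap-allFin-suc h ⟩
  h zero ++ concatMap (h ∘ suc) (allFin n)
    ≡⟨ cong (_++ concatMap (h ∘ suc) (allFin n)) (h≡[] zero λ ()) ⟩
  concatMap (h ∘ suc) (allFin n)
    ≡⟨ concatMap-allFin-single i (h ∘ suc) (λ j j≢i → h≡[] (suc j) (j≢i ∘ Finₚ.suc-injective)) ⟩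
  h (suc i) ∎
  where open ≡-Reasoning

map-++⁻ : ∀ (f : A → B) t xs {ys} → map f t ≡ xs ++ ys →
  ∃₂ λ t₁ t₂ → t ≡ t₁ ++ t₂ × xs ≡ map f t₁ × ys ≡ map f t₂
map-++⁻ f t [] eq = [] , t , refl , refl , sym eq
map-++⁻ f (x ∷ t) (_ ∷ xs) eq with ∷-injective eq
... | refl , eq′ with map-++⁻ f t xs eq′
...   | t₁ , t₂ , refl , refl , refl = x ∷ t₁ , t₂ , refl , refl , refl

⊆-++⁻ : ∀ {u : List A} xs {ys} → u ⊆ xs ++ ys →
  ∃₂ λ u₁ u₂ → u ≡ u₁ ++ u₂ × u₁ ⊆ xs × u₂ ⊆ ys
⊆-++⁻ {u = u} [] u⊆ = [] , u , refl , [] , u⊆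
⊆-++⁻ (x ∷ xs) (.x ∷ʳ u⊆) with ⊆-++⁻ xs u⊆
... | u₁ , u₂ , refl , u₁⊆ , u₂⊆ = u₁ , u₂ , refl , x ∷ʳ u₁⊆ , u₂⊆
⊆-++⁻ (x ∷ xs) (refl ∷ u⊆) with ⊆-++⁻ xs u⊆
... | u₁ , u₂ , refl , u₁⊆ , u₂⊆ = x ∷ u₁ , u₂ , refl , refl ∷ u₁⊆ , u₂⊆

iterate-unique : ∀ {f : A → A} {F : ℕ → A → List A} →
  (∀ u → F 0 u ≡ []) → (∀ k u → F (suc k) u ≡ u ∷ F k (f u)) → ∀ k u → F k u ≡ iterate f u k
iterate-unique F0 Fsuc zero u = F0 u
iterate-unique {f = f} {F} F0 Fsuc (suc k) u =
  trans (Fsuc k u) (cong (u ∷_) (iterate-unique {F = F} F0 Fsuc k (f u)))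

∈-iterate⁺ : ∀ (f : A → A) {j k} x → j < k → ℕ.iterate f x j ∈ iterate f x k
∈-iterate⁺ f {zero} x (s≤s _) = here refl
∈-iterate⁺ f {suc j} x (s≤s j<k@(s≤s _)) = there (∈-iterate⁺ f (f x) j<k)

-- Pattern containment

punchInℕ : ℕ → ℕ → ℕ
punchInℕ zero x = suc x
punchInℕ (suc i) zero = zero
punchInℕ (suc i) (suc x) = suc (punchInℕ i x)

OrderEmbedding : (ℕ → ℕ) → Set
OrderEmbedding f = ∀ a b → (f a <ᵇ f b) ≡ (a <ᵇ b)

punchInℕ-orderEmbedding : ∀ i → OrderEmbedding (punchInℕ i)
punchInℕ-orderEmbedding zero a b = refl
punchInℕ-orderEmbedding (suc i) zero zero = refl
punchInℕ-orderEmbedding (suc i) zero (suc b) = refl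
punchInℕ-orderEmbedding (suc i) (suc a) zero = refl
punchInℕ-orderEmbedding (suc i) (suc a) (suc b) = punchInℕ-orderEmbedding i a b

punchInℕ-suc : ∀ {i x} → x ≢ i → punchInℕ (suc i) x ≡ punchInℕ i x
punchInℕ-suc {zero} {zero} x≢i = ⊥-elim (x≢i refl)
punchInℕ-suc {zero} {suc x} _ = refl
punchInℕ-suc {suc i} {zero} _ = refl
punchInℕ-suc {suc i} {suc x} x≢i = cong suc (punchInℕ-suc (x≢i ∘ cong suc))

punchInℕ-≢ : ∀ i x → punchInℕ i x ≢ i
punchInℕ-≢ zero x ()
punchInℕ-≢ (suc i) (suc x) eq = punchInℕ-≢ i x (suc-injective eq)

∈-subseqs⁺ : ∀ {u w} → u ⊆ w → u ∈ subseqs w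
∈-subseqs⁺ [] = here refl
∈-subseqs⁺ {w = y ∷ w} (.y ∷ʳ u⊆w) = ∈-++⁺ʳ (map (y ∷_) (subseqs w)) (∈-subseqs⁺ u⊆w)
∈-subseqs⁺ (refl ∷ u⊆w) = ∈-++⁺ˡ (∈-map⁺ _ (∈-subseqs⁺ u⊆w))

∈-subseqs⁻ : ∀ {u} w → u ∈ subseqs w → u ⊆ w
∈-subseqs⁻ [] (here refl) = []
∈-subseqs⁻ (y ∷ w) u∈ with ∈-++⁻ (map (y ∷_) (subseqs w)) u∈
... | inj₁ u∈y∷ with ∈-map⁻ (y ∷_) u∈y∷
...   | v , v∈ , refl = refl ∷ ∈-subseqs⁻ w v∈
∈-subseqs⁻ (y ∷ w) u∈ | inj₂ u∈′ = y ∷ʳ ∈-subseqs⁻ w u∈′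

contains⁺ : ∀ {u w} τ → u ⊆ w → T (sameOrder u τ) → T (contains w τ)
contains⁺ τ u⊆w u≈τ = any⁺ (λ u → sameOrder u τ) (lose (∈-subseqs⁺ u⊆w) u≈τ)

contains⁻ : ∀ w τ → T (contains w τ) → ∃ λ u → u ⊆ w × T (sameOrder u τ)
contains⁻ w τ w⊇τ with find (any⁻ (λ u → sameOrder u τ) (subseqs w) w⊇τ)
... | u , u∈ , u≈τ = u , ∈-subseqs⁻ w u∈ , u≈τ

contains-mono : ∀ {u w} τ → u ⊆ w → T (contains u τ) → T (contains w τ)
contains-mono {u} τ u⊆w u⊇τ with contains⁻ u τ u⊇τ
... | v , v⊆u , v≈τ = contains⁺ τ (⊆-trans v⊆u u⊆w) v≈τ

sameOrder-length : ∀ u τ → T (sameOrder u τ) → length u ≡ length τ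
sameOrder-length [] [] _ = refl
sameOrder-length (a ∷ u) (b ∷ τ) h = cong suc (sameOrder-length u τ (proj₂ (T-∧⁻ h)))

module _ (f : ℕ → ℕ) (f-emb : OrderEmbedding f) where

  subseqs-map : ∀ w → subseqs (map f w) ≡ map (map f) (subseqs w)
  subseqs-map [] = refl
  subseqs-map (x ∷ w) = begin
    map (f x ∷_) (subseqs (map f w)) ++ subseqs (map f w)
      ≡⟨ cong (λ s → map (f x ∷_) s ++ s) (subseqs-map w) ⟩
    map (f x ∷_) (map (map f) (subseqs w)) ++ map (map f) (subseqs w)
      ≡⟨ cong (_++ map (map f) (subseqs w)) (trans (sym (map-∘ (subseqs w))) (map-∘ (subseqs w))) ⟩
    map (map f) (map (x ∷_) (subseqs w)) ++ map (map f) (subseqs w)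
      ≡⟨ map-++ (map f) (map (x ∷_) (subseqs w)) (subseqs w) ⟨
    map (map f) (map (x ∷_) (subseqs w) ++ subseqs w) ∎
    where open ≡-Reasoning

  sameOrder-map : ∀ u τ → sameOrder (map f u) τ ≡ sameOrder u τ
  sameOrder-map [] [] = refl
  sameOrder-map [] (_ ∷ _) = refl
  sameOrder-map (_ ∷ _) [] = refl
  sameOrder-map (a ∷ u) (b ∷ τ) = cong₂ _∧_ (comparisons u τ) (sameOrder-map u τ)
    where
    comparisons : ∀ u τ → and (map (λ p → (proj₁ p <ᵇ f a) == (proj₂ p <ᵇ b)) (zip (map f u) τ))
                        ≡ and (map (λ p → (proj₁ p <ᵇ a) == (proj₂ p <ᵇ b)) (zip u τ))
    comparisons [] _ = refl
    comparisons (_ ∷ _) [] = refl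
    comparisons (c ∷ u) (d ∷ τ) =
      cong₂ (λ x y → (x == (d <ᵇ b)) ∧ y) (f-emb c a) (comparisons u τ)

  contains-map : ∀ w τ → contains (map f w) τ ≡ contains w τ
  contains-map w τ = begin
    any (λ u → sameOrder u τ) (subseqs (map f w))
      ≡⟨ cong (any (λ u → sameOrder u τ)) (subseqs-map w) ⟩
    any (λ u → sameOrder u τ) (map (map f) (subseqs w))
      ≡⟨ cong or (map-∘ (subseqs w)) ⟨
    any (λ u → sameOrder (map f u) τ) (subseqs w)
      ≡⟨ cong or (map-cong (λ u → sameOrder-map u τ) (subseqs w)) ⟩
    any (λ u → sameOrder u τ) (subseqs w) ∎
    where open ≡-Reasoning

contains-punchIn : ∀ i w τ → contains (map (punchInℕ i) w) τ ≡ contains w τ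
contains-punchIn i = contains-map (punchInℕ i) (punchInℕ-orderEmbedding i)

contains-punchIn⁺ : ∀ i {u} w τ → u ⊆ map (punchInℕ i) w → T (sameOrder u τ) → T (contains w τ)
contains-punchIn⁺ i w τ u⊆ u≈ = subst T (contains-punchIn i w τ) (contains⁺ τ u⊆ u≈)

-- One-line forms and 2431

-- 2431 has an entry strictly between its first two, but no number lies strictly between 1 and 2.
1∷2∷-≉2431 : ∀ {u} → All (_≢ 1) u → ¬ T (sameOrder (1 ∷ 2 ∷ u) p2431)
1∷2∷-≉2431 {[]} _ ()
1∷2∷-≉2431 {zero ∷ _} _ ()
1∷2∷-≉2431 {suc zero ∷ _} (1≢1 ∷ _) _ = 1≢1 refl
1∷2∷-≉2431 {suc (suc _) ∷ _} _ h = proj₂ (T-∧⁻ h)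

contains-1∷2∷punchIn : ∀ w → All (_≢ 1) w →
  contains (1 ∷ 2 ∷ map (punchInℕ 1) w) p2431 ≡ contains (1 ∷ w) p2431
contains-1∷2∷punchIn w w≢1 = T-⇔⇒≡ (mk⇔ shrink grow)
  where
  W = map (punchInℕ 1) w
  punchIn2≡punchIn1 : map (punchInℕ 2) w ≡ W
  punchIn2≡punchIn1 = map-cong-local (All.map punchInℕ-suc w≢1)
  shrink : T (contains (1 ∷ 2 ∷ W) p2431) → T (contains (1 ∷ w) p2431)
  shrink h with contains⁻ (1 ∷ 2 ∷ W) p2431 h
  ... | _ , 1 ∷ʳ u⊆ , u≈ = contains-punchIn⁺ 1 (1 ∷ w) p2431 u⊆ u≈
  ... | _ , refl ∷ (2 ∷ʳ u⊆) , u≈ =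
    contains-punchIn⁺ 2 (1 ∷ w) p2431 (refl ∷ subst (_ ⊆_) (sym punchIn2≡punchIn1) u⊆) u≈
  ... | _ , refl ∷ (refl ∷ u⊆) , u≈ =
    ⊥-elim (1∷2∷-≉2431 (All-resp-⊆ u⊆ (All.map⁺ (All.universal (punchInℕ-≢ 1) w))) u≈)
  grow : T (contains (1 ∷ w) p2431) → T (contains (1 ∷ 2 ∷ W) p2431)
  grow h = contains-mono {u = 2 ∷ W} p2431 (1 ∷ʳ ⊆-refl)
             (subst T (sym (contains-punchIn 1 (1 ∷ w) p2431)) h)

-- Rotations, cycle forms and 1324

-- `rotations` recurses through a local function; `iterate-unique` identifies it by its equations.
rotations≡iterate : ∀ w → rotations w ≡ iterate rotate w (length w)
rotations≡iterate [] = refl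
rotations≡iterate (x ∷ xs)
  with iterate-unique {f = rotate} (λ _ → refl) (λ _ _ → refl) | length xs | xs ++ x ∷ []
... | go≡iterate | k | u = cong ((x ∷ xs) ∷_) (go≡iterate k u)

Rotation : List ℕ → List ℕ → Set
Rotation w r = ∃₂ λ A B → w ≡ A ++ B × r ≡ B ++ A

rotate-Rotation : ∀ {w u} → Rotation w u → Rotation w (rotate u)
rotate-Rotation ([] , [] , refl , refl) = [] , [] , refl , refl
rotate-Rotation (a ∷ A , [] , refl , refl) = a ∷ [] , A , cong (a ∷_) (++-identityʳ A) , refl
rotate-Rotation (A , b ∷ B , refl , refl) =
  A ++ b ∷ [] , B , sym (++-assoc A (b ∷ []) B) , ++-assoc B A (b ∷ [])

∈-iterate-rotate⁻ : ∀ {w r} k u → Rotation w u → r ∈ iterate rotate u k → Rotation w r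
∈-iterate-rotate⁻ (suc k) u rot (here refl) = rot
∈-iterate-rotate⁻ (suc k) u rot (there r∈) = ∈-iterate-rotate⁻ k (rotate u) (rotate-Rotation rot) r∈

∈-rotations⁻ : ∀ {r} w → r ∈ rotations w → Rotation w r
∈-rotations⁻ w r∈ = ∈-iterate-rotate⁻ (length w) w ([] , w , refl , sym (++-identityʳ w))
                      (subst (_ ∈_) (rotations≡iterate w) r∈)

iterate-rotate-++ : ∀ A B → ℕ.iterate rotate (A ++ B) (length A) ≡ B ++ A
iterate-rotate-++ [] B = sym (++-identityʳ B)
iterate-rotate-++ (a ∷ A) B = begin
  ℕ.iterate rotate ((A ++ B) ++ a ∷ []) (length A)
    ≡⟨ cong (λ w → ℕ.iterate rotate w (length A)) (++-assoc A B (a ∷ [])) ⟩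
  ℕ.iterate rotate (A ++ B ++ a ∷ []) (length A)
    ≡⟨ iterate-rotate-++ A (B ++ a ∷ []) ⟩
  (B ++ a ∷ []) ++ A
    ≡⟨ ++-assoc B (a ∷ []) A ⟩
  B ++ a ∷ A ∎
  where open ≡-Reasoning

∈-rotations⁺ : ∀ x A B → B ++ x ∷ A ∈ rotations (x ∷ A ++ B)
∈-rotations⁺ x A [] = here (cong (x ∷_) (sym (++-identityʳ A)))
∈-rotations⁺ x A (b ∷ B) =
  subst₂ _∈_ (iterate-rotate-++ (x ∷ A) (b ∷ B)) (sym (rotations≡iterate (x ∷ A ++ b ∷ B)))
    (∈-iterate⁺ rotate (x ∷ A ++ b ∷ B) (length-< A))
  where
  length-< : ∀ A {B} → length (x ∷ A) < length (x ∷ A ++ b ∷ B)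
  length-< [] = s≤s (s≤s z≤n)
  length-< (_ ∷ A) = s≤s (length-< A)

CyclicallyContains : List ℕ → List ℕ → Set
CyclicallyContains c τ = Any (λ r → T (contains r τ)) (rotations c)

CyclicallyContains-lift : ∀ {c c′ τ} →
  (∀ {r} → Rotation c r → T (contains r τ) → CyclicallyContains c′ τ) →
  CyclicallyContains c τ → CyclicallyContains c′ τ
CyclicallyContains-lift {c} lift cc with find cc
... | r , r∈ , r⊇τ = lift (∈-rotations⁻ c r∈) r⊇τ

cyclicallyAvoids : List ℕ → List ℕ → Bool
cyclicallyAvoids c τ = all (λ r → avoids r τ) (rotations c)

T-cyclicallyAvoids : ∀ c τ → T (cyclicallyAvoids c τ) ⇔ (¬ CyclicallyContains c τ)
T-cyclicallyAvoids c τ = mk⇔ to from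
  where
  to : T (cyclicallyAvoids c τ) → ¬ CyclicallyContains c τ
  to h cc with find cc
  ... | r , r∈ , r⊇τ = Equivalence.to T-not (All.lookup (All.all⁺ _ (rotations c) h) r∈) r⊇τ
  from : ¬ CyclicallyContains c τ → T (cyclicallyAvoids c τ)
  from ¬cc = All.all⁻ _ (All.tabulate λ r∈ →
    Equivalence.from T-not (λ r⊇τ → ¬cc (lose r∈ r⊇τ)))

cyclicallyAvoids-resp : ∀ {c c′ τ} → (CyclicallyContains c τ → CyclicallyContains c′ τ) →
  T (cyclicallyAvoids c′ τ) → T (cyclicallyAvoids c τ)
cyclicallyAvoids-resp {c} {c′} {τ} cc⇒cc′ h =
  Equivalence.from (T-cyclicallyAvoids c τ) (Equivalence.to (T-cyclicallyAvoids c′ τ) h ∘ cc⇒cc′)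

-- In 1324 the two smallest entries are not adjacent ...
0∷1-≉1324 : ∀ {a b} → All (2 ≤_) a → All (2 ≤_) b →
  ¬ T (sameOrder (a ++ 0 ∷ 1 ∷ b) p1324)
0∷1-≉1324 {[]} {[]} _ _ ()
0∷1-≉1324 {[]} {_ ∷ []} _ (s≤s (s≤s _) ∷ _) ()
0∷1-≉1324 {[]} {_ ∷ _ ∷ []} _ (s≤s (s≤s _) ∷ _) ()
0∷1-≉1324 {[]} {b@(_ ∷ _ ∷ _ ∷ _)} _ _ h with sameOrder-length (0 ∷ 1 ∷ b) p1324 h
... | ()
0∷1-≉1324 {_ ∷ []} (s≤s (s≤s _) ∷ _) _ ()
0∷1-≉1324 {x ∷ y ∷ []} (s≤s (s≤s _) ∷ _) _ with y <ᵇ x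
... | true = λ ()
... | false = λ ()
0∷1-≉1324 {a@(_ ∷ _ ∷ _ ∷ [])} {b} _ _ h
  with sameOrder-length (a ++ 0 ∷ 1 ∷ b) p1324 h
... | ()
0∷1-≉1324 {a@(_ ∷ _ ∷ _ ∷ _ ∷ [])} {b} _ _ h
  with sameOrder-length (a ++ 0 ∷ 1 ∷ b) p1324 h
... | ()
0∷1-≉1324 {a@(_ ∷ _ ∷ _ ∷ _ ∷ _ ∷ _)} {b} _ _ h
  with sameOrder-length (a ++ 0 ∷ 1 ∷ b) p1324 h
... | ()

-- ... and its smallest entry is not the last one.
1∷-∷0-≉1324 : ∀ {a} → All (2 ≤_) a → ¬ T (sameOrder (1 ∷ a ++ 0 ∷ []) p1324)
1∷-∷0-≉1324 {[]} _ ()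
1∷-∷0-≉1324 {_ ∷ []} (s≤s (s≤s _) ∷ _) ()
1∷-∷0-≉1324 {_ ∷ _ ∷ []} (s≤s (s≤s _) ∷ s≤s (s≤s _) ∷ _) ()
1∷-∷0-≉1324 {a@(_ ∷ _ ∷ _ ∷ [])} _ h with sameOrder-length (1 ∷ a ++ 0 ∷ []) p1324 h
... | ()
1∷-∷0-≉1324 {a@(_ ∷ _ ∷ _ ∷ _ ∷ _)} _ h with sameOrder-length (1 ∷ a ++ 0 ∷ []) p1324 h
... | ()

map-suc-≥2 : ∀ {t} → All (_≢ 0) t → All (2 ≤_) (map suc t)
map-suc-≥2 t≢0 = All.map⁺ (All.map (λ x≢0 → s≤s (n≢0⇒n>0 x≢0)) t≢0)

map-suc≡map-punchIn1 : ∀ {t} → All (_≢ 0) t → map suc t ≡ map (punchInℕ 1) t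
map-suc≡map-punchIn1 t≢0 = sym (map-cong-local (All.map punchInℕ-suc t≢0))

contains-0∷1-middle : ∀ t₁ t₂ → All (_≢ 0) t₁ → All (_≢ 0) t₂ →
  T (contains (map suc t₂ ++ 0 ∷ 1 ∷ map suc t₁) p1324) → T (contains (t₂ ++ 0 ∷ t₁) p1324)
contains-0∷1-middle t₁ t₂ t₁≢0 t₂≢0 h
  with contains⁻ (map suc t₂ ++ 0 ∷ 1 ∷ map suc t₁) p1324 h
... | u , u⊆ , u≈ with ⊆-++⁻ (map suc t₂) u⊆
...   | _ , _ , refl , u₁⊆ , 0 ∷ʳ u₂⊆ =
  contains-punchIn⁺ 0 (t₂ ++ 0 ∷ t₁) p1324
    (subst (_ ⊆_) (sym (map-++ suc t₂ (0 ∷ t₁))) (++⁺ u₁⊆ u₂⊆)) u≈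
...   | _ , _ , refl , u₁⊆ , refl ∷ (1 ∷ʳ u₂⊆) =
  contains-punchIn⁺ 1 (t₂ ++ 0 ∷ t₁) p1324 (subst (_ ⊆_) without-1 (++⁺ u₁⊆ (refl ∷ u₂⊆))) u≈
  where
  without-1 : map suc t₂ ++ 0 ∷ map suc t₁ ≡ map (punchInℕ 1) (t₂ ++ 0 ∷ t₁)
  without-1 = trans
    (cong₂ (λ xs ys → xs ++ 0 ∷ ys) (map-suc≡map-punchIn1 t₂≢0) (map-suc≡map-punchIn1 t₁≢0))
    (sym (map-++ (punchInℕ 1) t₂ (0 ∷ t₁)))
...   | _ , _ , refl , u₁⊆ , refl ∷ (refl ∷ u₂⊆) =
  ⊥-elim (0∷1-≉1324 (All-resp-⊆ u₁⊆ (map-suc-≥2 t₂≢0))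
                     (All-resp-⊆ u₂⊆ (map-suc-≥2 t₁≢0)) u≈)

contains-1∷-∷0 : ∀ t → All (_≢ 0) t → T (contains (1 ∷ map suc t ++ 0 ∷ []) p1324) →
  T (contains (0 ∷ t) p1324) ⊎ T (contains (t ++ 0 ∷ []) p1324)
contains-1∷-∷0 t t≢0 h with contains⁻ (1 ∷ map suc t ++ 0 ∷ []) p1324 h
... | u , 1 ∷ʳ u⊆ , u≈ =
  inj₂ (contains-punchIn⁺ 1 (t ++ 0 ∷ []) p1324 (subst (u ⊆_) without-1 u⊆) u≈)
  where
  without-1 : map suc t ++ 0 ∷ [] ≡ map (punchInℕ 1) (t ++ 0 ∷ [])
  without-1 = trans (cong (_++ 0 ∷ []) (map-suc≡map-punchIn1 t≢0))
                    (sym (map-++ (punchInℕ 1) t (0 ∷ [])))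
... | _ , refl ∷ u⊆ , u≈ with ⊆-++⁻ (map suc t) u⊆
...   | _ , _ , refl , u₁⊆ , 0 ∷ʳ [] =
  inj₁ (contains-punchIn⁺ 0 (0 ∷ t) p1324
          (refl ∷ subst (_ ⊆_) (++-identityʳ (map suc t)) (++⁺ u₁⊆ [])) u≈)
...   | _ , _ , refl , u₁⊆ , refl ∷ [] =
  ⊥-elim (1∷-∷0-≉1324 (All-resp-⊆ u₁⊆ (map-suc-≥2 t≢0)) u≈)

rotation-shrink : ∀ t → All (_≢ 0) t → ∀ {R} → Rotation (0 ∷ 1 ∷ map suc t) R →
  T (contains R p1324) → CyclicallyContains (0 ∷ t) p1324
rotation-shrink t t≢0 ([] , B , refl , refl) h =
  here (contains-0∷1-middle t [] t≢0 [] (subst (λ R → T (contains R p1324)) (++-identityʳ B) h))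
rotation-shrink t t≢0 (_ ∷ [] , _ , refl , refl) h with contains-1∷-∷0 t t≢0 h
... | inj₁ h′ = here h′
... | inj₂ h′ = lose (∈-rotations⁺ 0 [] t) h′
rotation-shrink t t≢0 (_ ∷ _ ∷ A , B , eq , refl) h with ∷-injective eq
... | refl , eq′ with ∷-injective eq′
...   | refl , eq″ with map-++⁻ suc t A eq″
...     | t₁ , t₂ , refl , refl , refl =
  lose (∈-rotations⁺ 0 t₁ t₂)
       (contains-0∷1-middle t₁ t₂ (All.++⁻ˡ t₁ t≢0) (All.++⁻ʳ t₁ t≢0) h)

rotation-grow : ∀ t τ {r} → Rotation (0 ∷ t) r → T (contains r τ) →
  CyclicallyContains (0 ∷ 1 ∷ map suc t) τ
rotation-grow t τ ([] , B , refl , refl) h =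
  here (contains-mono {u = 1 ∷ map suc t} τ (0 ∷ʳ ⊆-refl) (subst T (sym (contains-punchIn 0 (0 ∷ t) τ))
         (subst (λ r → T (contains r τ)) (++-identityʳ B) h)))
rotation-grow _ τ (_ ∷ A , B , refl , refl) h =
  subst (λ c → CyclicallyContains c τ) (cong (λ w → 0 ∷ 1 ∷ w) (sym (map-++ suc A B)))
    (lose (∈-rotations⁺ 0 (1 ∷ map suc A) (map suc B))
      (contains-mono τ map-suc⊆ (subst T (sym (contains-punchIn 0 (B ++ 0 ∷ A) τ)) h)))
  where
  map-suc⊆ : map suc (B ++ 0 ∷ A) ⊆ map suc B ++ 0 ∷ 1 ∷ map suc A
  map-suc⊆ = subst (_⊆ map suc B ++ 0 ∷ 1 ∷ map suc A) (sym (map-++ suc B (0 ∷ A)))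
                   (++⁺ ⊆-refl (0 ∷ʳ ⊆-refl))

cyclicallyAvoids-0∷1∷suc : ∀ t → All (_≢ 0) t →
  cyclicallyAvoids (0 ∷ 1 ∷ map suc t) p1324 ≡ cyclicallyAvoids (0 ∷ t) p1324
cyclicallyAvoids-0∷1∷suc t t≢0 = T-⇔⇒≡ (mk⇔
  (cyclicallyAvoids-resp (CyclicallyContains-lift (rotation-grow t p1324)))
  (cyclicallyAvoids-resp (CyclicallyContains-lift (rotation-shrink t t≢0))))

-- Orbits of cyclic permutations

distinct-∷⁻ : ∀ {x xs} → T (distinct (x ∷ xs)) → All (_≢ x) xs × T (distinct xs)
distinct-∷⁻ {x} h with T-∧⁻ h
... | x∉xs , d =
  All.tabulate (λ {y} y∈ y≡x →
    Equivalence.to T-not x∉xs (any⁺ (x ≡ᵇ_) (lose y∈ (≡⇒≡ᵇ x y (sym y≡x))))) , d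

module _ {n : ℕ} (v : Vec (Fin n) n) where

  iter-suc : ∀ k i → iter v (suc k) i ≡ iter v k (lookup v i)
  iter-suc zero i = refl
  iter-suc (suc k) i = cong (lookup v) (iter-suc k i)

  iter∈orbit : ∀ {j k} i → j < k → iter v j i ∈ orbit v k i
  iter∈orbit {zero} i (s≤s _) = here refl
  iter∈orbit {suc j} i (s≤s j<k@(s≤s _)) =
    there (subst (_∈ _) (sym (iter-suc j i)) (iter∈orbit (lookup v i) j<k))

  OrbitDistinct : ℕ → Fin n → Set
  OrbitDistinct k i = T (distinct (map toℕ (orbit v k i)))

  orbitDistinct-∷⁻ : ∀ {k} i → OrbitDistinct (suc k) i →
    All (_≢ toℕ i) (map toℕ (orbit v k (lookup v i))) × OrbitDistinct k (lookup v i)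
  orbitDistinct-∷⁻ i = distinct-∷⁻

  orbit-<⇒≢ : ∀ {j j′ k} i → OrbitDistinct k i → j < j′ → j′ < k → iter v j i ≢ iter v j′ i
  orbit-<⇒≢ {zero} {suc j′} {suc k} i d _ (s≤s j′<k) i≡ =
    All.lookup (proj₁ (orbitDistinct-∷⁻ {k} i d))
      (∈-map⁺ toℕ (subst (_∈ _) (trans (sym (iter-suc j′ i)) (sym i≡)) (iter∈orbit (lookup v i) j′<k)))
      refl
  orbit-<⇒≢ {suc j} {suc j′} {suc k} i d (s≤s j<j′) (s≤s j′<k) eq =
    orbit-<⇒≢ (lookup v i) (proj₂ (orbitDistinct-∷⁻ {k} i d)) j<j′ j′<k
      (trans (sym (iter-suc j i)) (trans eq (iter-suc j′ i)))

  orbit-injective : ∀ {j j′ k} i → OrbitDistinct k i → j < k → j′ < k →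
                    iter v j i ≡ iter v j′ i → j ≡ j′
  orbit-injective {j} {j′} i d j<k j′<k eq with <-cmp j j′
  ... | tri< j<j′ _ _ = ⊥-elim (orbit-<⇒≢ i d j<j′ j′<k eq)
  ... | tri≈ _ j≡j′ _ = j≡j′
  ... | tri> _ _ j′<j = ⊥-elim (orbit-<⇒≢ i d j′<j j<k (sym eq))

module _ {m : ℕ} (v : Vec (Fin (suc m)) (suc m)) (cyclic : T (isCyclic v)) where

  private
    N = suc m

    distinct-orbit : OrbitDistinct v N zero
    distinct-orbit = proj₁ (T-∧⁻ cyclic)

    iter-N : iter v N zero ≡ zero
    iter-N = toℕ-injective (≡ᵇ⇒≡ _ 0 (proj₂ (T-∧⁻ cyclic)))

  -- Pigeonhole on x, π⁰(0), …, π^{N-1}(0): as the orbit has no repeats, x is one of its points.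
  cyclic-orbit-surjective : ∀ x → ∃ λ a → a < N × iter v a zero ≡ x
  cyclic-orbit-surjective x with pigeonhole (n<1+n N) x∷orbit
    where
    x∷orbit : Fin (suc N) → Fin N
    x∷orbit zero = x
    x∷orbit (suc a) = iter v (toℕ a) zero
  ... | zero , suc a , _ , x≡ = toℕ a , toℕ<n a , sym x≡
  ... | suc a , suc b , s≤s a<b , eq = ⊥-elim (orbit-<⇒≢ v zero distinct-orbit a<b (toℕ<n b) eq)

  cyclic-lookup-injective : ∀ x y → lookup v x ≡ lookup v y → x ≡ y
  cyclic-lookup-injective x y eq with cyclic-orbit-surjective x | cyclic-orbit-surjective y
  ... | a , a<N , refl | b , b<N , refl =
    cong (λ c → iter v c zero) (suc-injective (next-injective a<N b<N eq))
    where
    -- π^{a+1}(0) is the point of index a+1 of the orbit if a+1 < N, and π⁰(0) otherwise.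
    next-injective : ∀ {a b} → a < N → b < N →
                     iter v (suc a) zero ≡ iter v (suc b) zero → suc a ≡ suc b
    next-injective a<N b<N eq with m≤n⇒m<n∨m≡n a<N | m≤n⇒m<n∨m≡n b<N
    ... | inj₁ a+1<N | inj₁ b+1<N = orbit-injective v zero distinct-orbit a+1<N b+1<N eq
    ... | inj₂ refl | inj₂ refl = refl
    ... | inj₂ refl | inj₁ b+1<N
      with orbit-injective v zero distinct-orbit (s≤s z≤n) b+1<N (trans (sym iter-N) eq)
    ...   | ()
    next-injective _ _ eq | inj₁ a+1<N | inj₂ refl
      with orbit-injective v zero distinct-orbit (s≤s z≤n) a+1<N (trans (sym iter-N) (sym eq))
    ...   | ()

-- The map π ↦ π′

toℕ-punchIn : ∀ {n} (i : Fin (suc n)) j → toℕ (punchIn i j) ≡ punchInℕ (toℕ i) (toℕ j)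
toℕ-punchIn zero j = refl
toℕ-punchIn (suc i) zero = refl
toℕ-punchIn (suc i) (suc j) = cong suc (toℕ-punchIn i j)

-- With 0-based values, the cycle (0 c₁ c₂ …) of v becomes (0 1 c₁+1 c₂+1 …).
insertAfter0 : ∀ {m} → Vec (Fin (suc m)) (suc m) → Vec (Fin (suc (suc m))) (suc (suc m))
insertAfter0 v = suc zero ∷ Vec.map (punchIn (suc zero)) v

NonZero : ∀ {n} → Fin n → Set
NonZero x = toℕ x ≢ 0

module _ {m : ℕ} (v : Vec (Fin (suc m)) (suc m)) where

  private
    G = insertAfter0 v

  lookup-insertAfter0 : ∀ i → NonZero (lookup v i) → lookup G (suc i) ≡ suc (lookup v i)
  lookup-insertAfter0 i nz with lookup v i | lookup-map i (punchIn (suc zero)) v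
  ... | zero | _ = ⊥-elim (nz refl)
  ... | suc _ | eq = eq

  orbit-insertAfter0 : ∀ k i → All NonZero (orbit v k (lookup v i)) →
    orbit G (suc k) (suc i) ≡ map suc (orbit v (suc k) i)
  orbit-insertAfter0 zero i _ = refl
  orbit-insertAfter0 (suc k) i (nz ∷ nzs) = cong (suc i ∷_) (begin
    orbit G (suc k) (lookup G (suc i))      ≡⟨ cong (orbit G (suc k)) (lookup-insertAfter0 i nz) ⟩
    orbit G (suc k) (suc (lookup v i))      ≡⟨ orbit-insertAfter0 k (lookup v i) nzs ⟩
    map suc (orbit v (suc k) (lookup v i))  ∎)
    where open ≡-Reasoning

  iter-insertAfter0 : ∀ k i → All NonZero (orbit v k (lookup v i)) →
    iter G (suc k) (suc i) ≡ punchIn (suc zero) (iter v (suc k) i)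
  iter-insertAfter0 zero i _ = lookup-map i (punchIn (suc zero)) v
  iter-insertAfter0 (suc k) i (nz ∷ nzs) = begin
    iter G (suc (suc k)) (suc i)                      ≡⟨ iter-suc G (suc k) (suc i) ⟩
    iter G (suc k) (lookup G (suc i))                 ≡⟨ cong (iter G (suc k)) (lookup-insertAfter0 i nz) ⟩
    iter G (suc k) (suc (lookup v i))                 ≡⟨ iter-insertAfter0 k (lookup v i) nzs ⟩
    punchIn (suc zero) (iter v (suc k) (lookup v i))  ≡⟨ cong (punchIn (suc zero)) (iter-suc v (suc k) i) ⟨
    punchIn (suc zero) (iter v (suc (suc k)) i)       ∎
    where open ≡-Reasoning

  orbit-insertAfter0-NonZero⁻ : ∀ k i → All NonZero (orbit G k (lookup G (suc i))) →
    All NonZero (orbit v k (lookup v i))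
  orbit-insertAfter0-NonZero⁻ zero i _ = []
  orbit-insertAfter0-NonZero⁻ (suc k) i (nz ∷ nzs) = vi≢0 ∷ orbit-insertAfter0-NonZero⁻ k (lookup v i)
    (subst (λ x → All NonZero (orbit G k (lookup G x))) (lookup-insertAfter0 i vi≢0) nzs)
    where
    vi≢0 : NonZero (lookup v i)
    vi≢0 vi≡0 = nz (trans (cong toℕ (lookup-map i (punchIn (suc zero)) v))
                    (trans (toℕ-punchIn (suc zero) (lookup v i)) (cong (punchInℕ 1) vi≡0)))

  OrbitNonZero : Set
  OrbitNonZero = All NonZero (orbit v m (lookup v zero))

  standardCycleForm-insertAfter0 : OrbitNonZero → standardCycleForm G ≡ 0 ∷ map suc (standardCycleForm v)
  standardCycleForm-insertAfter0 nz = cong (0 ∷_) (begin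
    map toℕ (orbit G (suc m) (suc zero))      ≡⟨ cong (map toℕ) (orbit-insertAfter0 m zero nz) ⟩
    map toℕ (map suc (orbit v (suc m) zero))  ≡⟨ map-∘ (orbit v (suc m) zero) ⟨
    map (suc ∘ toℕ) (orbit v (suc m) zero)    ≡⟨ map-∘ (orbit v (suc m) zero) ⟩
    map suc (standardCycleForm v)             ∎)
    where open ≡-Reasoning

  private
    any-suc : ∀ x s → any (suc x ≡ᵇ_) (map suc s) ≡ any (x ≡ᵇ_) s
    any-suc x [] = refl
    any-suc x (y ∷ s) = cong ((x ≡ᵇ y) ∨_) (any-suc x s)

    any-0-suc : ∀ s → any (0 ≡ᵇ_) (map suc s) ≡ false
    any-0-suc [] = refl
    any-0-suc (_ ∷ s) = any-0-suc s

    distinct-suc : ∀ s → distinct (map suc s) ≡ distinct s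
    distinct-suc [] = refl
    distinct-suc (x ∷ s) = cong₂ (λ a d → not a ∧ d) (any-suc x s) (distinct-suc s)

    punchIn-≡ᵇ0 : ∀ {k} (x : Fin (suc k)) → (toℕ (punchIn (suc zero) x) ≡ᵇ 0) ≡ (toℕ x ≡ᵇ 0)
    punchIn-≡ᵇ0 zero = refl
    punchIn-≡ᵇ0 (suc x) = refl

  OrbitNonZero⇒isCyclic-insertAfter0 : OrbitNonZero → isCyclic G ≡ isCyclic v
  OrbitNonZero⇒isCyclic-insertAfter0 nz = cong₂ _∧_
    (trans (cong distinct (standardCycleForm-insertAfter0 nz))
           (cong₂ (λ a d → not a ∧ d) (any-0-suc (standardCycleForm v))
                                         (distinct-suc (standardCycleForm v))))
    (trans (cong (λ x → toℕ x ≡ᵇ 0) (trans (iter-suc G (suc m) zero) (iter-insertAfter0 m zero nz)))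
           (punchIn-≡ᵇ0 (iter v (suc m) zero)))

  cyclic⇒OrbitNonZero : T (isCyclic v) → OrbitNonZero
  cyclic⇒OrbitNonZero c =
    All.map⁻ (proj₁ (orbitDistinct-∷⁻ v {m} zero (proj₁ (T-∧⁻ c))))

  cyclic-insertAfter0⇒OrbitNonZero : T (isCyclic G) → OrbitNonZero
  cyclic-insertAfter0⇒OrbitNonZero c with orbitDistinct-∷⁻ G {suc m} zero (proj₁ (T-∧⁻ c))
  ... | _ ∷ nzs , _ = orbit-insertAfter0-NonZero⁻ m zero (All.map⁻ nzs)

  isCyclic-insertAfter0 : isCyclic G ≡ isCyclic v
  isCyclic-insertAfter0 = T-⇔⇒≡ (mk⇔
    (λ c → subst T (OrbitNonZero⇒isCyclic-insertAfter0 (cyclic-insertAfter0⇒OrbitNonZero c)) c)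
    (λ c → subst T (sym (OrbitNonZero⇒isCyclic-insertAfter0 (cyclic⇒OrbitNonZero c))) c))

  oneLine-insertAfter0 : oneLine G ≡ 1 ∷ map (punchInℕ 1) (oneLine v)
  oneLine-insertAfter0 = cong (1 ∷_) (begin
    map toℕ (toList (Vec.map (punchIn (suc zero)) v))
      ≡⟨ cong (map toℕ) (toList-map (punchIn (suc zero)) v) ⟩
    map toℕ (map (punchIn (suc zero)) (toList v))
      ≡⟨ map-∘ (toList v) ⟨
    map (toℕ ∘ punchIn (suc zero)) (toList v)
      ≡⟨ map-cong (toℕ-punchIn (suc zero)) (toList v) ⟩
    map (punchInℕ 1 ∘ toℕ) (toList v)
      ≡⟨ map-∘ (toList v) ⟩
    map (punchInℕ 1) (oneLine v) ∎)
    where open ≡-Reasoning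

module _ {n : ℕ} where

  Omits : ∀ {k} → Fin n → Vec (Fin n) k → Set
  Omits i = VecAll.All (_≢ i)

  omits? : ∀ {k} (i : Fin n) → Decidable (Omits {k} i)
  omits? i = VecAll.all? (λ x → ¬? (x ≟ i))

  HeadOnly : ∀ {k} → Fin n → Vec (Fin n) (suc k) → Set
  HeadOnly i (x ∷ w) = x ≡ i × Omits i w

  headOnly? : ∀ {k} (i : Fin n) → Decidable (HeadOnly {k} i)
  headOnly? i (x ∷ w) = (x ≟ i) ×-dec omits? i w

filter-omits-allVecs : ∀ {n} (i : Fin (suc n)) k →
  filter (omits? i) (allVecs (suc n) k) ≡ map (Vec.map (punchIn i)) (allVecs n k)
filter-omits-allVecs i zero = refl
filter-omits-allVecs {n} i (suc k) = begin
  filter (omits? i) (concatMap (λ x → map (x ∷_) V) (allFin (suc n)))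
    ≡⟨ filter-concatMap (omits? i) (λ x → map (x ∷_) V) (allFin (suc n)) ⟩
  concatMap (λ x → filter (omits? i) (map (x ∷_) V)) (allFin (suc n))
    ≡⟨ concatMap-allFin-punchIn i _ (filter-none (omits? i)
         (All.map⁺ (All.universal (λ { _ (i≢i ∷ _) → i≢i refl }) V))) ⟩
  concatMap (λ y → filter (omits? i) (map (punchIn i y ∷_) V)) (allFin n)
    ≡⟨ concatMap-cong column (allFin n) ⟩
  concatMap (λ y → map (Vec.map (punchIn i)) (map (y ∷_) W)) (allFin n)
    ≡⟨ map-concatMap (Vec.map (punchIn i)) (λ y → map (y ∷_) W) (allFin n) ⟨
  map (Vec.map (punchIn i)) (concatMap (λ y → map (y ∷_) W) (allFin n)) ∎
  where
  open ≡-Reasoning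
  V = allVecs (suc n) k
  W = allVecs n k
  column : ∀ y → filter (omits? i) (map (punchIn i y ∷_) V) ≡ map (Vec.map (punchIn i)) (map (y ∷_) W)
  column y = begin
    filter (omits? i) (map (punchIn i y ∷_) V)
      ≡⟨ filter-map (omits? i) (punchIn i y ∷_) V ⟩
    map (punchIn i y ∷_) (filter (omits? i ∘ (punchIn i y ∷_)) V)
      ≡⟨ cong (map (punchIn i y ∷_))
           (filter-≐ _ (omits? i) ((λ { (_ ∷ h) → h }) , (punchInᵢ≢i i y ∷_)) V) ⟩
    map (punchIn i y ∷_) (filter (omits? i) V)
      ≡⟨ cong (map (punchIn i y ∷_)) (filter-omits-allVecs i k) ⟩
    map (punchIn i y ∷_) (map (Vec.map (punchIn i)) W)
      ≡⟨ map-∘ W ⟨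
    map (λ w → punchIn i y ∷ Vec.map (punchIn i) w) W
      ≡⟨ map-∘ W ⟩
    map (Vec.map (punchIn i)) (map (y ∷_) W) ∎

filter-headOnly-allVecs : ∀ {n} (i : Fin (suc n)) k →
  filter (headOnly? i) (allVecs (suc n) (suc k)) ≡ map (λ w → i ∷ Vec.map (punchIn i) w) (allVecs n k)
filter-headOnly-allVecs {n} i k = begin
  filter (headOnly? i) (concatMap (λ x → map (x ∷_) V) (allFin (suc n)))
    ≡⟨ filter-concatMap (headOnly? i) (λ x → map (x ∷_) V) (allFin (suc n)) ⟩
  concatMap (λ x → filter (headOnly? i) (map (x ∷_) V)) (allFin (suc n))
    ≡⟨ concatMap-allFin-single i _ (λ x x≢i → filter-none (headOnly? i)
         (All.map⁺ (All.universal (λ _ h → x≢i (proj₁ h)) V))) ⟩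
  filter (headOnly? i) (map (i ∷_) V)
    ≡⟨ filter-map (headOnly? i) (i ∷_) V ⟩
  map (i ∷_) (filter (headOnly? i ∘ (i ∷_)) V)
    ≡⟨ cong (map (i ∷_)) (filter-≐ _ (omits? i) (proj₂ , (refl ,_)) V) ⟩
  map (i ∷_) (filter (omits? i) V)
    ≡⟨ cong (map (i ∷_)) (filter-omits-allVecs i k) ⟩
  map (i ∷_) (map (Vec.map (punchIn i)) (allVecs n k))
    ≡⟨ map-∘ (allVecs n k) ⟨
  map (λ w → i ∷ Vec.map (punchIn i) w) (allVecs n k) ∎
  where
  open ≡-Reasoning
  V = allVecs (suc n) k

-- Counting

selected : ∀ {n} → List ℕ → Vec (Fin n) n → Bool
selected p v = inA p2431 p1324 v ∧ startsWith p (standardCycleForm v)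

selected⁻ : ∀ {n} p (v : Vec (Fin n) n) → T (selected p v) →
  T (isCyclic v) × T (startsWith p (standardCycleForm v))
selected⁻ p v h = proj₁ (T-∧⁻ (proj₁ (T-∧⁻ h))) , proj₂ (T-∧⁻ h)

cyclic-Omits-head : ∀ {m x} {w : Vec (Fin (suc m)) m} → T (isCyclic (x ∷ w)) → Omits x w
cyclic-Omits-head {x = x} {w} cyclic =
  lookup⁻ λ i wi≡x → 0≢1+n (sym (cyclic-lookup-injective (x ∷ w) cyclic (suc i) zero wi≡x))

startsWith-0∷1⇒head≡1 : ∀ {m} p (v : Vec (Fin (suc (suc m))) (suc (suc m))) →
  T (startsWith (0 ∷ 1 ∷ p) (standardCycleForm v)) → lookup v zero ≡ suc zero
startsWith-0∷1⇒head≡1 p v s = toℕ-injective (sym (≡ᵇ⇒≡ 1 _ (proj₁ (T-∧⁻ s))))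

selected⇒HeadOnly : ∀ {m} p (w : Vec (Fin (suc (suc m))) (suc (suc m))) →
  T (selected (0 ∷ 1 ∷ p) w) → HeadOnly (suc zero) w
selected⇒HeadOnly p w@(_ ∷ _) h with selected⁻ (0 ∷ 1 ∷ p) w h
... | cyclic , s with startsWith-0∷1⇒head≡1 p w s
...   | refl = refl , cyclic-Omits-head cyclic

contains-oneLine-insertAfter0 : ∀ {m} (v : Vec (Fin (suc (suc m))) (suc (suc m))) → T (isCyclic v) →
  lookup v zero ≡ suc zero → contains (oneLine (insertAfter0 v)) p2431 ≡ contains (oneLine v) p2431
contains-oneLine-insertAfter0 v@(_ ∷ w) cyclic refl =
  trans (cong (λ l → contains l p2431) (oneLine-insertAfter0 v))
        (contains-1∷2∷punchIn (map toℕ (toList w))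
          (All.map⁺ (toList⁺ (VecAll.map (_∘ toℕ-injective) (cyclic-Omits-head cyclic)))))

selected-insertAfter0 : ∀ {m} (v : Vec (Fin (suc (suc m))) (suc (suc m))) →
  selected (0 ∷ 1 ∷ 2 ∷ []) (insertAfter0 v) ≡ selected (0 ∷ 1 ∷ []) v
selected-insertAfter0 v = ∧-cong-under (isCyclic-insertAfter0 v)
  (λ c → cong (startsWith (0 ∷ 1 ∷ 2 ∷ [])) (cycleForm c))
  (λ c s → cong₂ _∧_
    (cong not (contains-oneLine-insertAfter0 v c (startsWith-0∷1⇒head≡1 [] v s)))
    (trans (cong (λ c → cyclicallyAvoids c p1324) (cycleForm c))
           (cyclicallyAvoids-0∷1∷suc _ (All.map⁺ (cyclic⇒OrbitNonZero v c)))))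
  where
  cycleForm : T (isCyclic v) → standardCycleForm (insertAfter0 v) ≡ 0 ∷ map suc (standardCycleForm v)
  cycleForm c = standardCycleForm-insertAfter0 v (cyclic⇒OrbitNonZero v c)

count-insertAfter0 : ∀ m →
  countA (3 + m) p2431 p1324 (0 ∷ 1 ∷ 2 ∷ []) ≡ countA (2 + m) p2431 p1324 (0 ∷ 1 ∷ [])
count-insertAfter0 m = begin
  length (filterᵇ big (allVecs N N))
    ≡⟨ cong length (filter-restrict (T? ∘ big) (headOnly? (suc zero))
         (λ {w} → selected⇒HeadOnly (2 ∷ []) w) (allVecs N N)) ⟩
  length (filterᵇ big (filter (headOnly? (suc zero)) (allVecs N N)))
    ≡⟨ cong (length ∘ filterᵇ big) (filter-headOnly-allVecs (suc zero) M) ⟩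
  length (filterᵇ big (map insertAfter0 (allVecs M M)))
    ≡⟨ cong length (filter-map (T? ∘ big) insertAfter0 (allVecs M M)) ⟩
  length (map insertAfter0 (filterᵇ (big ∘ insertAfter0) (allVecs M M)))
    ≡⟨ length-map insertAfter0 (filterᵇ (big ∘ insertAfter0) (allVecs M M)) ⟩
  length (filterᵇ (big ∘ insertAfter0) (allVecs M M))
    ≡⟨ cong length (filter-≐ (T? ∘ big ∘ insertAfter0) (T? ∘ small)
         ((λ {v} → subst T (selected-insertAfter0 v)) , (λ {v} → subst T (sym (selected-insertAfter0 v))))
         (allVecs M M)) ⟩
  length (filterᵇ small (allVecs M M)) ∎
  where
  open ≡-Reasoning
  M = 2 + m
  N = 3 + m
  big : Vec (Fin N) N → Bool
  big = selected (0 ∷ 1 ∷ 2 ∷ [])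
  small : Vec (Fin M) M → Bool
  small = selected (0 ∷ 1 ∷ [])

lemma2p4 : (n : ℕ) → 5 ≤ n →
    countA n p2431 p1324 (0 ∷ 1 ∷ 2 ∷ []) ≡ countA (n ∸ 1) p2431 p1324 (0 ∷ 1 ∷ [])
lemma2p4 (suc (suc (suc m))) (s≤s (s≤s (s≤s _))) = count-insertAfter0 m
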